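{- For all $n\ge 0$, $ss_n=2\,hs_n+1$, and \[hs_n=\frac{1}{2}\left(\sum_{k=0}^{n}\binom{n+k}{2k}\binom{2k}{k}-1\right).\]
   Context: A Schröder path of order $n$ is a lattice path from $(0,0)$ to $(n,n)$ using steps $U=(0,1)$, $D=(1,0)$ and $F=(1,1)$ that never goes below the line $y=x$. A super Schröder path of order $n$ is a lattice path from $(0,0)$ to $(n,n)$ with these steps and no restriction relative to the line $y=x$. A hump in such a path is a factor of consecutive steps of the form $UF^jD$ with $j\ge 0$. $ss_n$ is the number of super Schröder paths of order $n$, and $hs_n$ is the total number of humps in all Schröder paths of order $n$ (summed over all such paths). -}

module Defs where

open import Data.Nat using (ℕ; zero; suc; _+_; _*_; _≤ᵇ_; _≡ᵇ_)
open import Data.Nat.Combinatorics using (_C_)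
open import Data.Bool using (Bool; true; false; _∧_; if_then_else_)
open import Data.List using (List; []; _∷_; map; concatMap; length; filterᵇ; upTo; concat; applyUpTo)
open import Data.Nat.ListAction using (sum)
open import Data.Integer using (ℤ; +_; _-_; 0ℤ) renaming (_+_ to _+ℤ_)
open import Data.Integer.Properties using (_≤?_)
open import Relation.Nullary.Decidable using (⌊_⌋)

-- Steps: U = (0,1), D = (1,0), F = (1,1)
data Step : Set where
  U D F : Step

-- A lattice path starting at (0,0) is a word in the steps.
Path : Set
Path = List Step

words : ℕ → List Path
words zero    = [] ∷ []
words (suc L) = concatMap (λ w → (U ∷ w) ∷ (D ∷ w) ∷ (F ∷ w) ∷ []) (words L)

-- all words of length at most L (each word occurs exactly once)
wordsUpTo : ℕ → List Path
wordsUpTo L = concat (applyUpTo words (suc L))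

xEnd yEnd : Path → ℕ
xEnd []      = 0
xEnd (U ∷ p) = xEnd p
xEnd (D ∷ p) = suc (xEnd p)
xEnd (F ∷ p) = suc (xEnd p)
yEnd []      = 0
yEnd (U ∷ p) = suc (yEnd p)
yEnd (D ∷ p) = yEnd p
yEnd (F ∷ p) = suc (yEnd p)

endsAt : ℕ → Path → Bool
endsAt n p = (xEnd p ≡ᵇ n) ∧ (yEnd p ≡ᵇ n)

-- never goes below y = x: starting from height h = y - x ≥ 0,
-- every point visited has y - x ≥ 0
aboveFrom : ℤ → Path → Bool
aboveFrom h []      = true
aboveFrom h (U ∷ p) = aboveFrom (h +ℤ + 1) p
aboveFrom h (F ∷ p) = aboveFrom h p
aboveFrom h (D ∷ p) = ⌊ 0ℤ ≤? (h - + 1) ⌋ ∧ aboveFrom (h - + 1) p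

neverBelow : Path → Bool
neverBelow = aboveFrom 0ℤ

-- every path to (n,n) has length between n and 2n
superSchroder : ℕ → List Path
superSchroder n = filterᵇ (endsAt n) (wordsUpTo (n + n))

schroder : ℕ → List Path
schroder n = filterᵇ neverBelow (superSchroder n)

startsFD : Path → Bool
startsFD []      = false
startsFD (D ∷ p) = true
startsFD (F ∷ p) = startsFD p
startsFD (U ∷ p) = false

-- number of humps (factors U F^j D, j ≥ 0); each hump is identified by its initial U
humps : Path → ℕ
humps []      = 0
humps (U ∷ p) = (if startsFD p then 1 else 0) + humps p
humps (D ∷ p) = humps p
humps (F ∷ p) = humps p

ss : ℕ → ℕ
ss n = length (superSchroder n)

hs : ℕ → ℕ
hs n = sum (map humps (schroder n))

centralSum : ℕ → ℕ
centralSum n = sum (map (λ k → ((n + k) C (k + k)) * ((k + k) C k)) (upTo (suc n)))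

module Submission where

-- Every count in the statement is the total of a weight over the words in
-- {U,D,F} of bounded length.  Such totals obey a first-step decomposition (a word
-- is empty or a step followed by a shorter word), which identifies each count with
-- a recursively defined table; the theorem becomes identities between tables.
-- * p(L,x,y), the words of length L ending at (x,y), has the trinomial closed form
--   p(f+u+d, f+d, f+u) = C(f+u+d, u+d) C(u+d, u), and Σ_L p(L,x,y) is the Delannoy
--   number D(x,y); hence ss n = D(n,n) = centralSum n.
-- * Schröder tails are paths from height h (= y - x) down to the diagonal with b
--   steps U or F, never going below it; R(h,b) counts them, E(h,b) those starting
--   with F^j D, and S(h,b) their humps, so that hs n = S(0,n).
-- * The reflection principle R(h,b) = D(h+b,b) - D(h+b+1,b-1), a split of R by the
--   first non-flat step, and induction on b give 2 S(h,b) + (h+1) Y(h,b) =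
--   (h+1) D(h+b,b) with Y(h,b) = E(h,b) + [h = 0]; at h = 0, 2 hs n + 1 = D(n,n).

open import Defs
open import Data.Bool using (Bool; true; false; _∧_; if_then_else_)
open import Data.Bool.Properties using (∧-zeroʳ)
open import Data.Integer using () renaming (+_ to pos)
open import Data.List using (List; []; _∷_; map; concat; concatMap; applyUpTo; filterᵇ; length; _++_)
open import Data.List.Properties using (map-++; map-cong)
open import Data.Nat using (ℕ; zero; suc; _+_; _*_; _≤_; _<_; z≤n; s≤s; s≤s⁻¹; _≡ᵇ_)
open import Data.Nat.Combinatorics using (_C_; nCk+nC[k+1]≡[n+1]C[k+1]; k>n⇒nCk≡0)
open import Data.Nat.ListAction using (sum)
open import Data.Nat.ListAction.Properties using (sum-++)
open import Data.Nat.Properties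
open import Data.Nat.Tactic.RingSolver using (solve-∀)
open import Data.Product using (_×_; _,_)
open import Function using (_∘_)
open import Relation.Binary.PropositionalEquality
open import Algebra.Properties.CommutativeSemigroup +-commutativeSemigroup using (interchange)
open ≡-Reasoning

+₃-cong : ∀ {a a′ b b′ c c′ : ℕ} → a ≡ a′ → b ≡ b′ → c ≡ c′ → a + b + c ≡ a′ + b′ + c′
+₃-cong p q r = cong₂ _+_ (cong₂ _+_ p q) r

Σ< : ℕ → (ℕ → ℕ) → ℕ
Σ< n g = sum (applyUpTo g n)

Σ<-cong-< : ∀ n {g h : ℕ → ℕ} → (∀ k → k < n → g k ≡ h k) → Σ< n g ≡ Σ< n h
Σ<-cong-< zero    _   = refl
Σ<-cong-< (suc n) g≗h = cong₂ _+_ (g≗h 0 (s≤s z≤n)) (Σ<-cong-< n (λ k k<n → g≗h (suc k) (s≤s k<n)))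

Σ<-cong : ∀ n {g h : ℕ → ℕ} → (∀ k → g k ≡ h k) → Σ< n g ≡ Σ< n h
Σ<-cong n g≗h = Σ<-cong-< n (λ k _ → g≗h k)

Σ<-zero : ∀ n {g : ℕ → ℕ} → (∀ k → g k ≡ 0) → Σ< n g ≡ 0
Σ<-zero zero    _   = refl
Σ<-zero (suc n) g≡0 = cong₂ _+_ (g≡0 0) (Σ<-zero n (g≡0 ∘ suc))

Σ<-+ : ∀ n (g h : ℕ → ℕ) → Σ< n (λ k → g k + h k) ≡ Σ< n g + Σ< n h
Σ<-+ zero    g h = refl
Σ<-+ (suc n) g h = trans (cong (g 0 + h 0 +_) (Σ<-+ n (g ∘ suc) (h ∘ suc))) (interchange (g 0) (h 0) _ _)

Σ<-+₃ : ∀ n (f g h : ℕ → ℕ) → Σ< n (λ k → f k + g k + h k) ≡ Σ< n f + Σ< n g + Σ< n h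
Σ<-+₃ n f g h = trans (Σ<-+ n (λ k → f k + g k) h) (cong (_+ Σ< n h) (Σ<-+ n f g))

Σ<-drop : ∀ n m (g : ℕ → ℕ) → (∀ k → k < n → g k ≡ 0) → Σ< (n + m) g ≡ Σ< m (λ k → g (n + k))
Σ<-drop zero    m g _   = refl
Σ<-drop (suc n) m g g≡0 = cong₂ _+_ (g≡0 0 (s≤s z≤n)) (Σ<-drop n m (g ∘ suc) (λ k k<n → g≡0 (suc k) (s≤s k<n)))

module _ {A : Set} where

  sum-map-cong : ∀ {f g : A → ℕ} xs → (∀ x → f x ≡ g x) → sum (map f xs) ≡ sum (map g xs)
  sum-map-cong xs f≗g = cong sum (map-cong f≗g xs)

  sum-map-zero : ∀ {f : A → ℕ} xs → (∀ x → f x ≡ 0) → sum (map f xs) ≡ 0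
  sum-map-zero []       _   = refl
  sum-map-zero (x ∷ xs) f≡0 = cong₂ _+_ (f≡0 x) (sum-map-zero xs f≡0)

  sum-map-+ : ∀ (f g : A → ℕ) xs → sum (map (λ x → f x + g x) xs) ≡ sum (map f xs) + sum (map g xs)
  sum-map-+ f g []       = refl
  sum-map-+ f g (x ∷ xs) = trans (cong (f x + g x +_) (sum-map-+ f g xs)) (interchange (f x) (g x) _ _)

  sum-map-++ : ∀ (f : A → ℕ) xs ys → sum (map f (xs ++ ys)) ≡ sum (map f xs) + sum (map f ys)
  sum-map-++ f xs ys = trans (cong sum (map-++ f xs ys)) (sum-++ (map f xs) (map f ys))

  length≡sum-map-1 : ∀ (xs : List A) → length xs ≡ sum (map (λ _ → 1) xs)
  length≡sum-map-1 []       = refl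
  length≡sum-map-1 (x ∷ xs) = cong suc (length≡sum-map-1 xs)

  sum-map-filterᵇ : ∀ (p : A → Bool) (g : A → ℕ) xs →
    sum (map g (filterᵇ p xs)) ≡ sum (map (λ x → if p x then g x else 0) xs)
  sum-map-filterᵇ p g []       = refl
  sum-map-filterᵇ p g (x ∷ xs) with p x
  ... | true  = cong (g x +_) (sum-map-filterᵇ p g xs)
  ... | false = sum-map-filterᵇ p g xs

  sum-map-applyUpTo : ∀ (f : A → ℕ) (xs : ℕ → A) n → sum (map f (applyUpTo xs n)) ≡ Σ< n (f ∘ xs)
  sum-map-applyUpTo f xs zero    = refl
  sum-map-applyUpTo f xs (suc n) = cong (f (xs 0) +_) (sum-map-applyUpTo f (xs ∘ suc) n)

  sum-map-concat-applyUpTo : ∀ (xs : ℕ → List A) (f : A → ℕ) n →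
    sum (map f (concat (applyUpTo xs n))) ≡ Σ< n (λ L → sum (map f (xs L)))
  sum-map-concat-applyUpTo xs f zero    = refl
  sum-map-concat-applyUpTo xs f (suc n) =
    trans (sum-map-++ f (xs 0) _) (cong (sum (map f (xs 0)) +_) (sum-map-concat-applyUpTo (xs ∘ suc) f n))

Σwords : ℕ → (Path → ℕ) → ℕ
Σwords L f = sum (map f (words L))

Σ<words : ℕ → (Path → ℕ) → ℕ
Σ<words n f = Σ< n (λ L → Σwords L f)

Σwords-zero : ∀ L {f : Path → ℕ} → (∀ w → f w ≡ 0) → Σwords L f ≡ 0
Σwords-zero L = sum-map-zero (words L)

sum-map-extend : ∀ (f : Path → ℕ) ws →
  sum (map f (concatMap (λ w → (U ∷ w) ∷ (D ∷ w) ∷ (F ∷ w) ∷ []) ws))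
    ≡ sum (map (f ∘ (U ∷_)) ws) + sum (map (f ∘ (D ∷_)) ws) + sum (map (f ∘ (F ∷_)) ws)
sum-map-extend f []       = refl
sum-map-extend f (w ∷ ws) =
  trans (cong (λ t → f (U ∷ w) + (f (D ∷ w) + (f (F ∷ w) + t))) (sum-map-extend f ws))
        (regroup (f (U ∷ w)) (f (D ∷ w)) (f (F ∷ w)) _ _ _)
  where
  regroup : ∀ a b c x y z → a + (b + (c + (x + y + z))) ≡ a + x + (b + y) + (c + z)
  regroup = solve-∀

Σwords-suc : ∀ L f → Σwords (suc L) f ≡ Σwords L (f ∘ (U ∷_)) + Σwords L (f ∘ (D ∷_)) + Σwords L (f ∘ (F ∷_))
Σwords-suc L f = sum-map-extend f (words L)

Σ<words-cong : ∀ n {f g : Path → ℕ} → (∀ w → f w ≡ g w) → Σ<words n f ≡ Σ<words n g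
Σ<words-cong n f≗g = Σ<-cong n (λ L → sum-map-cong (words L) f≗g)

Σ<words-zero : ∀ n {f : Path → ℕ} → (∀ w → f w ≡ 0) → Σ<words n f ≡ 0
Σ<words-zero n f≡0 = Σ<-zero n (λ L → Σwords-zero L f≡0)

Σ<words-+ : ∀ n (f g : Path → ℕ) → Σ<words n (λ w → f w + g w) ≡ Σ<words n f + Σ<words n g
Σ<words-+ n f g = trans (Σ<-cong n (λ L → sum-map-+ f g (words L))) (Σ<-+ n _ _)

Σ<words-suc : ∀ n f → Σ<words (suc n) f
  ≡ f [] + (Σ<words n (f ∘ (U ∷_)) + Σ<words n (f ∘ (D ∷_)) + Σ<words n (f ∘ (F ∷_)))
Σ<words-suc n f = cong₂ _+_ (+-identityʳ (f []))
  (trans (Σ<-cong n (λ L → Σwords-suc L f)) (Σ<-+₃ n _ _ _))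

by-first-step : ∀ n f {e u d v} → f [] ≡ e →
  Σ<words n (f ∘ (U ∷_)) ≡ u → Σ<words n (f ∘ (D ∷_)) ≡ d → Σ<words n (f ∘ (F ∷_)) ≡ v →
  Σ<words (suc n) f ≡ e + (u + d + v)
by-first-step n f e u d v = trans (Σ<words-suc n f) (cong₂ _+_ e (+₃-cong u d v))

endpoint : ℕ → ℕ → Path → ℕ
endpoint x y w = if (xEnd w ≡ᵇ x) ∧ (yEnd w ≡ᵇ y) then 1 else 0

prev : (ℕ → ℕ) → ℕ → ℕ
prev g zero    = 0
prev g (suc n) = g n

prev-zero : ∀ {g : ℕ → ℕ} m → (∀ k → g k ≡ 0) → prev g m ≡ 0
prev-zero zero    _   = refl
prev-zero (suc m) g≡0 = g≡0 m

-- nPaths L x y: words of length L ending at (x, y), split by first step U, D, F.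
nPaths : ℕ → ℕ → ℕ → ℕ
nPaths zero    x y = endpoint x y []
nPaths (suc L) x y = prev (nPaths L x) y + prev (λ x′ → nPaths L x′ y) x + prev (λ x′ → prev (nPaths L x′) y) x

paths-count : ∀ L x y → Σwords L (endpoint x y) ≡ nPaths L x y
paths-count zero    x y = +-identityʳ (endpoint x y [])
paths-count (suc L) x y = trans (Σwords-suc L (endpoint x y)) (+₃-cong (viaU x y) (viaD x y) (viaF x y))
  where
  viaU : ∀ x y → Σwords L (λ w → endpoint x y (U ∷ w)) ≡ prev (nPaths L x) y
  viaU x zero    = Σwords-zero L (λ w → cong (λ c → if c then 1 else 0) (∧-zeroʳ (xEnd w ≡ᵇ x)))
  viaU x (suc y) = paths-count L x y
  viaD : ∀ x y → Σwords L (λ w → endpoint x y (D ∷ w)) ≡ prev (λ x′ → nPaths L x′ y) x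
  viaD zero    y = Σwords-zero L (λ _ → refl)
  viaD (suc x) y = paths-count L x y
  viaF : ∀ x y → Σwords L (λ w → endpoint x y (F ∷ w)) ≡ prev (λ x′ → prev (nPaths L x′) y) x
  viaF zero    y       = Σwords-zero L (λ _ → refl)
  viaF (suc x) zero    = Σwords-zero L (λ w → cong (λ c → if c then 1 else 0) (∧-zeroʳ (xEnd w ≡ᵇ x)))
  viaF (suc x) (suc y) = paths-count L x y

nPaths-x>L : ∀ L x y → L < x → nPaths L x y ≡ 0
nPaths-x>L zero    (suc x) y _          = refl
nPaths-x>L (suc L) (suc x) y (s≤s L<x) =
  +₃-cong (prev-zero y (λ y′ → nPaths-x>L L (suc x) y′ (m<n⇒m<1+n L<x)))
          (nPaths-x>L L x y L<x)
          (prev-zero y (λ y′ → nPaths-x>L L x y′ L<x))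

nPaths-y>L : ∀ L x y → L < y → nPaths L x y ≡ 0
nPaths-y>L zero    zero    (suc y) _ = refl
nPaths-y>L zero    (suc x) (suc y) _ = refl
nPaths-y>L (suc L) x (suc y) (s≤s L<y) =
  +₃-cong (nPaths-y>L L x y L<y)
          (prev-zero x (λ x′ → nPaths-y>L L x′ (suc y) (m<n⇒m<1+n L<y)))
          (prev-zero x (λ x′ → nPaths-y>L L x′ y L<y))

-- From (x + 1, y + 1) every step decreases the coordinate sum.
shrink-U : ∀ {x y n} → suc x + suc y ≤ n → suc x + y < n
shrink-U {x} {y} {n} = subst (λ t → suc t ≤ n) (+-suc x y)

shrink-F : ∀ {x y n} → suc x + suc y ≤ n → x + y < n
shrink-F {x} {y} = ≤-trans (s≤s (+-monoʳ-≤ x (n≤1+n y)))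

nPaths-short : ∀ L x y → x + y < L → nPaths L x y ≡ 0
nPaths-short (suc L) zero    zero    _          = refl
nPaths-short (suc L) (suc x) zero    (s≤s x<L)  = cong (_+ 0) (nPaths-short L x 0 x<L)
nPaths-short (suc L) zero    (suc y) (s≤s y<L)  = cong (λ t → t + 0 + 0) (nPaths-short L 0 y y<L)
nPaths-short (suc L) (suc x) (suc y) (s≤s bd)   =
  +₃-cong (nPaths-short L (suc x) y (shrink-U bd)) (nPaths-short L x (suc y) bd) (nPaths-short L x y (shrink-F bd))

-- Pascal's rule on both factors of (L C m) (m C u); the three terms on the left
-- are the words of length L + 1 starting with U, D and F respectively.
pascal-step : ∀ L m u →
  (L C m) * (m C u) + (L C m) * (m C suc u) + (L C suc m) * (suc m C suc u) ≡ (suc L C suc m) * (suc m C suc u)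
pascal-step L m u = begin
    (L C m) * (m C u) + (L C m) * (m C suc u) + (L C suc m) * (suc m C suc u)
  ≡⟨ cong (_+ (L C suc m) * (suc m C suc u)) (sym (*-distribˡ-+ (L C m) (m C u) (m C suc u))) ⟩
    (L C m) * (m C u + m C suc u) + (L C suc m) * (suc m C suc u)
  ≡⟨ cong (λ t → (L C m) * t + (L C suc m) * (suc m C suc u)) (nCk+nC[k+1]≡[n+1]C[k+1] m u) ⟩
    (L C m) * (suc m C suc u) + (L C suc m) * (suc m C suc u)
  ≡⟨ sym (*-distribʳ-+ (suc m C suc u) (L C m) (L C suc m)) ⟩
    (L C m + L C suc m) * (suc m C suc u)
  ≡⟨ cong (_* (suc m C suc u)) (nCk+nC[k+1]≡[n+1]C[k+1] L m) ⟩
    (suc L C suc m) * (suc m C suc u) ∎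

-- The same without U steps (m C 0 = 1).
pascal-step₀ : ∀ L m → (L C m) * 1 + (L C suc m) * 1 ≡ (suc L C suc m) * 1
pascal-step₀ L m = trans (sym (*-distribʳ-+ 1 (L C m) (L C suc m))) (cong (_* 1) (nCk+nC[k+1]≡[n+1]C[k+1] L m))

C-vanishˡ : ∀ {L m} a → L ≡ m → 0 ≡ (L C suc m) * a
C-vanishˡ {L} a refl = sym (cong (_* a) (k>n⇒nCk≡0 {L} {suc L} ≤-refl))

C-vanishʳ : ∀ {m u} a → m ≡ u → 0 ≡ a * (m C suc u)
C-vanishʳ {m} a refl = sym (trans (cong (a *_) (k>n⇒nCk≡0 {m} {suc m} ≤-refl)) (*-zeroʳ a))

shift-D : ∀ L u d → (L C (suc u + d)) * ((suc u + d) C suc u) ≡ (L C (u + suc d)) * ((u + suc d) C suc u)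
shift-D L u d = cong (λ t → (L C t) * (t C suc u)) (sym (+-suc u d))

-- Trinomial closed form: the words with f steps F, u steps U and d steps D number
-- C(f+u+d, u+d) C(u+d, u).
trinomial : ∀ L x y f u d → L ≡ f + (u + d) → x ≡ f + d → y ≡ f + u →
  nPaths L x y ≡ (L C (u + d)) * ((u + d) C u)
trinomial zero    _ _ zero    zero    zero    refl refl refl = refl
trinomial zero    _ _ (suc f) u       d       () _ _
trinomial zero    _ _ zero    (suc u) d       () _ _
trinomial zero    _ _ zero    zero    (suc d) () _ _
trinomial (suc L) _ _ zero    zero    zero    () _ _
trinomial (suc L) _ _ (suc f) zero    zero    eq refl refl =
  +₃-cong (nPaths-x>L L _ _ (≤-reflexive (cong suc L≡)))
          (nPaths-y>L L _ _ (≤-reflexive (cong suc L≡)))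
          (trinomial L _ _ f 0 0 L≡ refl refl)
  where L≡ : L ≡ f + 0
        L≡ = suc-injective eq
trinomial (suc L) _ _ zero    (suc u) zero    eq refl refl =
  trans (+₃-cong (trinomial L _ _ 0 u 0 L≡ refl refl) (C-vanishʳ (L C (u + 0)) (+-identityʳ u)) (C-vanishˡ _ L≡))
        (pascal-step L (u + 0) u)
  where L≡ : L ≡ u + 0
        L≡ = suc-injective eq
trinomial (suc L) _ _ zero    zero    (suc d) eq refl refl =
  trans (+₃-cong refl (trinomial L _ _ 0 0 d L≡ refl refl) (C-vanishˡ 1 L≡)) (pascal-step₀ L d)
  where L≡ : L ≡ d
        L≡ = suc-injective eq
trinomial (suc L) _ _ zero    (suc u) (suc d) eq refl refl =
  trans (+₃-cong (trinomial L _ _ 0 u (suc d) L≡ refl refl)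
                 (trans (trinomial L _ _ 0 (suc u) d (trans L≡ (+-suc u d)) refl refl) (shift-D L u d))
                 (trans (nPaths-short L d u (≤-reflexive (trans (cong suc (+-comm d u)) (sym L≡′))))
                        (C-vanishˡ _ L≡)))
        (pascal-step L (u + suc d) u)
  where L≡ : L ≡ u + suc d
        L≡ = suc-injective eq
        L≡′ : L ≡ suc (u + d)
        L≡′ = trans L≡ (+-suc u d)
trinomial (suc L) _ _ (suc f) (suc u) zero    eq refl refl =
  trans (+₃-cong (trinomial L _ _ (suc f) u 0 (trans L≡ (+-suc f (u + 0))) refl (+-suc f u))
                 (trans (nPaths-y>L L _ _ (≤-reflexive (cong suc (trans L≡ (cong (f +_) (cong suc (+-identityʳ u)))))))
                        (C-vanishʳ (L C (u + 0)) (+-identityʳ u)))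
                 (trinomial L _ _ f (suc u) 0 L≡ refl refl))
        (pascal-step L (u + 0) u)
  where L≡ : L ≡ f + suc (u + 0)
        L≡ = suc-injective eq
trinomial (suc L) _ _ (suc f) zero    (suc d) eq refl refl =
  trans (+₃-cong (nPaths-x>L L _ _ (≤-reflexive (cong suc L≡)))
                 (trinomial L _ _ (suc f) 0 d (trans L≡ (+-suc f d)) (+-suc f d) refl)
                 (trinomial L _ _ f 0 (suc d) L≡ refl refl))
        (pascal-step₀ L d)
  where L≡ : L ≡ f + suc d
        L≡ = suc-injective eq
trinomial (suc L) _ _ (suc f) (suc u) (suc d) eq refl refl =
  trans (+₃-cong (trinomial L _ _ (suc f) u (suc d) (trans L≡ (+-suc f (u + suc d))) refl (+-suc f u))
                 (trans (trinomial L _ _ (suc f) (suc u) d (trans L≡ (shift f u d)) (+-suc f d) refl)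
                        (shift-D L u d))
                 (trinomial L _ _ f (suc u) (suc d) L≡ refl refl))
        (pascal-step L (u + suc d) u)
  where L≡ : L ≡ f + (suc u + suc d)
        L≡ = suc-injective eq
        shift : ∀ f u d → f + (suc u + suc d) ≡ suc f + (suc u + d)
        shift = solve-∀

-- The words of length n + k ending at (n, n): n - k flat steps, k up and k down.
paths-diagonal : ∀ n k → k ≤ n → nPaths (n + k) n n ≡ ((n + k) C (k + k)) * ((k + k) C k)
paths-diagonal n k k≤n with m≤n⇒∃[o]m+o≡n k≤n
... | j , refl = trinomial (k + j + k) (k + j) (k + j) j k k (reorder k j) (+-comm k j) (+-comm k j)
  where
  reorder : ∀ k j → k + j + k ≡ j + (k + k)
  reorder = solve-∀

paths-centralSum : ∀ n → Σ< (suc (n + n)) (λ L → nPaths L n n) ≡ centralSum n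
paths-centralSum n = begin
    Σ< (suc (n + n)) (λ L → nPaths L n n)
  ≡⟨ cong (λ t → Σ< t (λ L → nPaths L n n)) (sym (+-suc n n)) ⟩
    Σ< (n + suc n) (λ L → nPaths L n n)
  ≡⟨ Σ<-drop n (suc n) (λ L → nPaths L n n) (λ L L<n → nPaths-x>L L n n L<n) ⟩
    Σ< (suc n) (λ k → nPaths (n + k) n n)
  ≡⟨ Σ<-cong-< (suc n) (λ k k<1+n → paths-diagonal n k (s≤s⁻¹ k<1+n)) ⟩
    Σ< (suc n) (λ k → ((n + k) C (k + k)) * ((k + k) C k))
  ≡⟨ sum-map-applyUpTo (λ k → ((n + k) C (k + k)) * ((k + k) C k)) (λ k → k) (suc n) ⟨
    centralSum n ∎

-- D(x, y): all paths to (x, y), by first step U, D, F.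
delannoy : ℕ → ℕ → ℕ
delannoy zero    zero    = 1
delannoy (suc x) zero    = delannoy x zero
delannoy zero    (suc y) = delannoy zero y
delannoy (suc x) (suc y) = delannoy (suc x) y + delannoy x (suc y) + delannoy x y

-- Words to (x, y) have length ≤ x + y, so summing over longer lengths gives D(x, y).
paths-delannoy : ∀ n x y → x + y < n → Σ< n (λ L → nPaths L x y) ≡ delannoy x y
paths-delannoy (suc n) zero    zero    _          = cong (1 +_) (Σ<-zero n (λ _ → refl))
paths-delannoy (suc n) (suc x) zero    (s≤s bd)   =
  trans (Σ<-cong n (λ L → +-identityʳ (nPaths L x 0))) (paths-delannoy n x 0 bd)
paths-delannoy (suc n) zero    (suc y) (s≤s bd)   =
  trans (Σ<-cong n (λ L → trans (+-identityʳ _) (+-identityʳ (nPaths L 0 y)))) (paths-delannoy n 0 y bd)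
paths-delannoy (suc n) (suc x) (suc y) (s≤s bd)   =
  trans (Σ<-+₃ n _ _ _)
        (+₃-cong (paths-delannoy n (suc x) y (shrink-U bd)) (paths-delannoy n x (suc y) bd)
                 (paths-delannoy n x y (shrink-F bd)))

ss-paths : ∀ n → ss n ≡ Σ< (suc (n + n)) (λ L → nPaths L n n)
ss-paths n = begin
    length (filterᵇ (endsAt n) W)
  ≡⟨ length≡sum-map-1 (filterᵇ (endsAt n) W) ⟩
    sum (map (λ _ → 1) (filterᵇ (endsAt n) W))
  ≡⟨ sum-map-filterᵇ (endsAt n) (λ _ → 1) W ⟩
    sum (map (endpoint n n) W)
  ≡⟨ sum-map-concat-applyUpTo words (endpoint n n) (suc (n + n)) ⟩
    Σ<words (suc (n + n)) (endpoint n n)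
  ≡⟨ Σ<-cong (suc (n + n)) (λ L → paths-count L n n) ⟩
    Σ< (suc (n + n)) (λ L → nPaths L n n) ∎
  where W : List Path
        W = wordsUpTo (n + n)

-- w is a Schröder tail from height h with b steps U or F: it ends at (h + b, b)
-- and never goes below height 0 when started at height h.
isTail : ℕ → ℕ → Path → Bool
isTail h b w = aboveFrom (pos h) w ∧ (xEnd w ≡ᵇ h + b) ∧ (yEnd w ≡ᵇ b)

onTails : (Path → ℕ) → ℕ → ℕ → Path → ℕ
onTails g h b w = if isTail h b w then g w else 0

∧-false : ∀ a c → a ∧ c ∧ false ≡ false
∧-false a c = trans (cong (a ∧_) (∧-zeroʳ c)) (∧-zeroʳ a)

-- How being a tail changes under a first step; a D step from height 0 is not
-- allowed, and U, F need a rising step to spare.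
onTails-U₀ : ∀ g h w → onTails g h 0 (U ∷ w) ≡ 0
onTails-U₀ g h w = cong (λ c → if c then g (U ∷ w) else 0) (∧-false (aboveFrom (pos (h + 1)) w) (xEnd w ≡ᵇ h + 0))

onTails-F₀ : ∀ g h w → onTails g h 0 (F ∷ w) ≡ 0
onTails-F₀ g h w = cong (λ c → if c then g (F ∷ w) else 0) (∧-false (aboveFrom (pos h) w) (suc (xEnd w) ≡ᵇ h + 0))

onTails-[] : ∀ g h b → onTails g h (suc b) [] ≡ 0
onTails-[] g h b = cong (λ c → if c then g [] else 0) (∧-zeroʳ _)

onTails-U : ∀ g h b w → onTails g h (suc b) (U ∷ w) ≡ onTails (g ∘ (U ∷_)) (suc h) b w
onTails-U g h b w = cong (λ c → if c then g (U ∷ w) else 0)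
  (cong₂ (λ k l → aboveFrom (pos k) w ∧ (xEnd w ≡ᵇ l) ∧ (yEnd w ≡ᵇ b)) (+-comm h 1) (+-suc h b))

onTails-F : ∀ g h b w → onTails g h (suc b) (F ∷ w) ≡ onTails (g ∘ (F ∷_)) h b w
onTails-F g h b w = cong (λ c → if c then g (F ∷ w) else 0)
  (cong (λ l → aboveFrom (pos h) w ∧ (suc (xEnd w) ≡ᵇ l) ∧ (yEnd w ≡ᵇ b)) (+-suc h b))

onTails-+ : ∀ f g h b w → onTails (λ v → f v + g v) h b w ≡ onTails f h b w + onTails g h b w
onTails-+ f g h b w with isTail h b w
... | true  = refl
... | false = refl

onTails-0 : ∀ h b w → onTails (λ _ → 0) h b w ≡ 0
onTails-0 h b w with isTail h b w
... | true  = refl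
... | false = refl

-- R(h, b): number of tails, by first step U, D, F.
tails : ℕ → ℕ → ℕ
tails zero    zero    = 1
tails (suc h) zero    = tails h zero
tails zero    (suc b) = tails 1 b + tails 0 b
tails (suc h) (suc b) = tails (suc (suc h)) b + tails h (suc b) + tails (suc h) b

-- E(h, b): number of tails starting with F^j D.
drops : ℕ → ℕ → ℕ
drops zero    b       = 0
drops (suc h) zero    = tails h zero
drops (suc h) (suc b) = tails h (suc b) + drops (suc h) b

-- S(h, b): total number of humps in the tails; a U starts a hump exactly when it
-- is followed by a tail counted in E.
tailHumps : ℕ → ℕ → ℕ
tailHumps zero    zero    = 0
tailHumps (suc h) zero    = tailHumps h zero
tailHumps zero    (suc b) = drops 1 b + tailHumps 1 b + tailHumps 0 b
tailHumps (suc h) (suc b) = drops (suc (suc h)) b + tailHumps (suc (suc h)) b + tailHumps h (suc b) + tailHumps (suc h) b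

one : Path → ℕ
one _ = 1

startsWithDrop : Path → ℕ
startsWithDrop w = if startsFD w then 1 else 0

-- A tail from height h with b rising steps has length ≤ h + 2b; the bounds
-- below are those of the tails reached after a U or F step.
bound-U : ∀ h b {n} → h + suc b + suc b < suc n → suc h + b + b < n
bound-U h b {n} bd = s≤s⁻¹ (subst (_< suc n) (size h b) bd)
  where size : ∀ h b → h + suc b + suc b ≡ suc (suc (h + b + b))
        size = solve-∀

bound-F : ∀ h b {n} → h + suc b + suc b < suc n → h + b + b < n
bound-F h b bd = ≤-trans (n≤1+n _) (bound-U h b bd)

tails-count : ∀ n h b → h + b + b < n → Σ<words n (onTails one h b) ≡ tails h b
tails-count (suc n) zero zero _ =
  by-first-step n (onTails one 0 0) refl
    (Σ<words-zero n (onTails-U₀ one 0))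
    (Σ<words-zero n (λ _ → refl))
    (Σ<words-zero n (onTails-F₀ one 0))
tails-count (suc n) (suc h) zero (s≤s bd) =
  trans (by-first-step n (onTails one (suc h) 0) refl
          (Σ<words-zero n (onTails-U₀ one (suc h)))
          (tails-count n h 0 bd)
          (Σ<words-zero n (onTails-F₀ one (suc h))))
        (+-identityʳ (tails h 0))
tails-count (suc n) zero (suc b) bd =
  trans (by-first-step n (onTails one 0 (suc b)) (onTails-[] one 0 b)
          (trans (Σ<words-cong n (onTails-U one 0 b)) (tails-count n 1 b (bound-U 0 b bd)))
          (Σ<words-zero n (λ _ → refl))
          (trans (Σ<words-cong n (onTails-F one 0 b)) (tails-count n 0 b (bound-F 0 b bd))))
        (cong (_+ tails 0 b) (+-identityʳ (tails 1 b)))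
tails-count (suc n) (suc h) (suc b) bd =
  by-first-step n (onTails one (suc h) (suc b)) (onTails-[] one (suc h) b)
    (trans (Σ<words-cong n (onTails-U one (suc h) b)) (tails-count n (suc (suc h)) b (bound-U (suc h) b bd)))
    (tails-count n h (suc b) (s≤s⁻¹ bd))
    (trans (Σ<words-cong n (onTails-F one (suc h) b)) (tails-count n (suc h) b (bound-F (suc h) b bd)))

no-drop-after-U : ∀ n h b → Σ<words n (λ w → onTails startsWithDrop h (suc b) (U ∷ w)) ≡ 0
no-drop-after-U n h b = Σ<words-zero n (λ w → trans (onTails-U startsWithDrop h b w) (onTails-0 (suc h) b w))

drops-count : ∀ n h b → h + b + b < n → Σ<words n (onTails startsWithDrop h b) ≡ drops h b
drops-count (suc n) zero zero _ =
  by-first-step n (onTails startsWithDrop 0 0) refl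
    (Σ<words-zero n (onTails-U₀ startsWithDrop 0))
    (Σ<words-zero n (λ _ → refl))
    (Σ<words-zero n (onTails-F₀ startsWithDrop 0))
drops-count (suc n) (suc h) zero (s≤s bd) =
  trans (by-first-step n (onTails startsWithDrop (suc h) 0) refl
          (Σ<words-zero n (onTails-U₀ startsWithDrop (suc h)))
          (tails-count n h 0 bd)
          (Σ<words-zero n (onTails-F₀ startsWithDrop (suc h))))
        (+-identityʳ (tails h 0))
drops-count (suc n) zero (suc b) bd =
  by-first-step n (onTails startsWithDrop 0 (suc b)) (onTails-[] startsWithDrop 0 b)
    (no-drop-after-U n 0 b)
    (Σ<words-zero n (λ _ → refl))
    (trans (Σ<words-cong n (onTails-F startsWithDrop 0 b)) (drops-count n 0 b (bound-F 0 b bd)))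
drops-count (suc n) (suc h) (suc b) bd =
  by-first-step n (onTails startsWithDrop (suc h) (suc b)) (onTails-[] startsWithDrop (suc h) b)
    (no-drop-after-U n (suc h) b)
    (tails-count n h (suc b) (s≤s⁻¹ bd))
    (trans (Σ<words-cong n (onTails-F startsWithDrop (suc h) b)) (drops-count n (suc h) b (bound-F (suc h) b bd)))

-- After a U, the weight counts the hump possibly started by that U plus the
-- humps of the rest; the count of the latter is an argument, so that
-- humps-count below stays structurally recursive.
humps-after-U : ∀ n h b → suc h + b + b < n → Σ<words n (onTails humps (suc h) b) ≡ tailHumps (suc h) b →
  Σ<words n (λ w → onTails humps h (suc b) (U ∷ w)) ≡ drops (suc h) b + tailHumps (suc h) b
humps-after-U n h b bd rest = begin
    Σ<words n (λ w → onTails humps h (suc b) (U ∷ w))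
  ≡⟨ Σ<words-cong n (λ w → trans (onTails-U humps h b w) (onTails-+ startsWithDrop humps (suc h) b w)) ⟩
    Σ<words n (λ w → onTails startsWithDrop (suc h) b w + onTails humps (suc h) b w)
  ≡⟨ Σ<words-+ n _ _ ⟩
    Σ<words n (onTails startsWithDrop (suc h) b) + Σ<words n (onTails humps (suc h) b)
  ≡⟨ cong₂ _+_ (drops-count n (suc h) b bd) rest ⟩
    drops (suc h) b + tailHumps (suc h) b ∎

humps-count : ∀ n h b → h + b + b < n → Σ<words n (onTails humps h b) ≡ tailHumps h b
humps-count (suc n) zero zero _ =
  by-first-step n (onTails humps 0 0) refl
    (Σ<words-zero n (onTails-U₀ humps 0))
    (Σ<words-zero n (λ _ → refl))
    (Σ<words-zero n (onTails-F₀ humps 0))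
humps-count (suc n) (suc h) zero (s≤s bd) =
  trans (by-first-step n (onTails humps (suc h) 0) refl
          (Σ<words-zero n (onTails-U₀ humps (suc h)))
          (humps-count n h 0 bd)
          (Σ<words-zero n (onTails-F₀ humps (suc h))))
        (+-identityʳ (tailHumps h 0))
humps-count (suc n) zero (suc b) bd =
  trans (by-first-step n (onTails humps 0 (suc b)) (onTails-[] humps 0 b)
          (humps-after-U n 0 b (bound-U 0 b bd) (humps-count n 1 b (bound-U 0 b bd)))
          (Σ<words-zero n (λ _ → refl))
          (trans (Σ<words-cong n (onTails-F humps 0 b)) (humps-count n 0 b (bound-F 0 b bd))))
        (cong (_+ tailHumps 0 b) (+-identityʳ _))
humps-count (suc n) (suc h) (suc b) bd =
  by-first-step n (onTails humps (suc h) (suc b)) (onTails-[] humps (suc h) b)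
    (humps-after-U n (suc h) b (bound-U (suc h) b bd) (humps-count n (suc (suc h)) b (bound-U (suc h) b bd)))
    (humps-count n h (suc b) (s≤s⁻¹ bd))
    (trans (Σ<words-cong n (onTails-F humps (suc h) b)) (humps-count n (suc h) b (bound-F (suc h) b bd)))

hs-tailHumps : ∀ n → hs n ≡ tailHumps 0 n
hs-tailHumps n = begin
    sum (map humps (filterᵇ neverBelow (filterᵇ (endsAt n) W)))
  ≡⟨ sum-map-filterᵇ neverBelow humps (filterᵇ (endsAt n) W) ⟩
    sum (map (λ w → if neverBelow w then humps w else 0) (filterᵇ (endsAt n) W))
  ≡⟨ sum-map-filterᵇ (endsAt n) (λ w → if neverBelow w then humps w else 0) W ⟩
    sum (map (λ w → if endsAt n w then (if neverBelow w then humps w else 0) else 0) W)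
  ≡⟨ sum-map-cong W (λ w → nested-if (endsAt n w) (neverBelow w) (humps w)) ⟩
    sum (map (onTails humps 0 n) W)
  ≡⟨ sum-map-concat-applyUpTo words (onTails humps 0 n) (suc (n + n)) ⟩
    Σ<words (suc (n + n)) (onTails humps 0 n)
  ≡⟨ humps-count (suc (n + n)) 0 n ≤-refl ⟩
    tailHumps 0 n ∎
  where
  W : List Path
  W = wordsUpTo (n + n)
  nested-if : ∀ e a x → (if e then (if a then x else 0) else 0) ≡ (if a ∧ e then x else 0)
  nested-if true  true  x = refl
  nested-if true  false x = refl
  nested-if false true  x = refl
  nested-if false false x = refl

-- With no rising steps left, the only tail is D^h and it has no humps; the
-- only paths to a point on an axis are straight.
tails-x-axis : ∀ h → tails h 0 ≡ 1
tails-x-axis zero    = refl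
tails-x-axis (suc h) = tails-x-axis h

tailHumps-x-axis : ∀ h → tailHumps h 0 ≡ 0
tailHumps-x-axis zero    = refl
tailHumps-x-axis (suc h) = tailHumps-x-axis h

delannoy-x-axis : ∀ x → delannoy x 0 ≡ 1
delannoy-x-axis zero    = refl
delannoy-x-axis (suc x) = delannoy-x-axis x

delannoy-y-axis : ∀ y → delannoy 0 y ≡ 1
delannoy-y-axis zero    = refl
delannoy-y-axis (suc y) = delannoy-y-axis y

-- Exchanging U and D steps.
delannoy-sym : ∀ x y → delannoy x y ≡ delannoy y x
delannoy-sym zero    zero    = refl
delannoy-sym zero    (suc y) = trans (delannoy-y-axis (suc y)) (sym (delannoy-x-axis (suc y)))
delannoy-sym (suc x) zero    = trans (delannoy-x-axis (suc x)) (sym (delannoy-y-axis (suc x)))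
delannoy-sym (suc x) (suc y) =
  trans (+₃-cong (delannoy-sym (suc x) y) (delannoy-sym x (suc y)) (delannoy-sym x y))
        (cong (_+ delannoy y x) (+-comm (delannoy y (suc x)) (delannoy (suc y) x)))

delannoy↓ : ℕ → ℕ → ℕ
delannoy↓ x zero    = 0
delannoy↓ x (suc c) = delannoy x c

delannoy-suc : ∀ x c → delannoy (suc x) c ≡ delannoy↓ (suc x) c + delannoy x c + delannoy↓ x c
delannoy-suc x zero    = sym (+-identityʳ (delannoy x 0))
delannoy-suc x (suc c) = refl

-- Reflection principle: of the D(h+b, b) words ending h below their start level,
-- those going below it are in bijection (reflect the part before the first
-- crossing) with the words to (h + b + 1, b - 1).
reflection : ∀ h b → delannoy↓ (suc (h + b)) b + tails h b ≡ delannoy (h + b) b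
reflection h zero = trans (tails-x-axis h) (sym (delannoy-x-axis (h + 0)))
reflection zero (suc c) = begin
    delannoy (suc (suc c)) c + (tails 1 c + tails 0 c)
  ≡⟨ cong (_+ (tails 1 c + tails 0 c)) (delannoy-suc (suc c) c) ⟩
    delannoy↓ (suc (suc c)) c + delannoy (suc c) c + delannoy↓ (suc c) c + (tails 1 c + tails 0 c)
  ≡⟨ regroup (delannoy↓ (suc (suc c)) c) (delannoy (suc c) c) (delannoy↓ (suc c) c) (tails 1 c) (tails 0 c) ⟩
    (delannoy↓ (suc (suc c)) c + tails 1 c) + delannoy (suc c) c + (delannoy↓ (suc c) c + tails 0 c)
  ≡⟨ +₃-cong (reflection 1 c) (delannoy-sym (suc c) c) (reflection 0 c) ⟩
    delannoy (suc c) c + delannoy c (suc c) + delannoy c c ∎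
  where
  regroup : ∀ a b d r s → a + b + d + (r + s) ≡ (a + r) + b + (d + s)
  regroup = solve-∀
reflection (suc h) (suc c) = begin
    delannoy (suc (suc x)) c + (tails (suc (suc h)) c + tails h (suc c) + tails (suc h) c)
  ≡⟨ cong (_+ (tails (suc (suc h)) c + tails h (suc c) + tails (suc h) c)) (delannoy-suc (suc x) c) ⟩
    delannoy↓ (suc (suc x)) c + delannoy (suc x) c + delannoy↓ (suc x) c
      + (tails (suc (suc h)) c + tails h (suc c) + tails (suc h) c)
  ≡⟨ interchange₃ (delannoy↓ (suc (suc x)) c) (delannoy (suc x) c) (delannoy↓ (suc x) c)
                  (tails (suc (suc h)) c) (tails h (suc c)) (tails (suc h) c) ⟩
    (delannoy↓ (suc (suc x)) c + tails (suc (suc h)) c) + (delannoy (suc x) c + tails h (suc c))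
      + (delannoy↓ (suc x) c + tails (suc h) c)
  ≡⟨ +₃-cong (subst (λ t → delannoy↓ (suc (suc t)) c + tails (suc (suc h)) c ≡ delannoy (suc t) c) e
                    (reflection (suc (suc h)) c))
             (reflection h (suc c))
             (subst (λ t → delannoy↓ (suc t) c + tails (suc h) c ≡ delannoy t c) e (reflection (suc h) c)) ⟩
    delannoy (suc x) c + delannoy x (suc c) + delannoy x c ∎
  where
  x : ℕ
  x = h + suc c
  e : suc (h + c) ≡ x
  e = sym (+-suc h c)
  interchange₃ : ∀ a b d r s t → a + b + d + (r + s + t) ≡ (a + r) + (b + s) + (d + t)
  interchange₃ = solve-∀

-- Y(h, b): tails whose first non-flat step is not U; for h = 0 this is only the
-- all-flat tail F^b, for h > 0 these are the tails counted by E.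
nonRising : ℕ → ℕ → ℕ
nonRising zero    b = 1
nonRising (suc h) b = drops (suc h) b

-- Tails starting F^j U correspond to tails from two levels higher starting F^j D
-- (replace that U by D, which also uses up one rising step).
tails-split : ∀ h c → tails h (suc c) ≡ drops (suc (suc h)) c + nonRising h (suc c)
tails-split zero    zero    = refl
tails-split zero    (suc c) =
  trans (cong (tails 1 (suc c) +_) (tails-split 0 c)) (sym (+-assoc (tails 1 (suc c)) (drops 2 c) 1))
tails-split (suc h) zero    = +-assoc (tails (suc (suc h)) 0) (tails h 1) (tails h 0)
tails-split (suc h) (suc c) =
  trans (cong (a + b +_) (tails-split (suc h) c)) (regroup a b (drops (suc h) (suc c)) (drops (suc (suc (suc h))) c))
  where
  a b : ℕ
  a = tails (suc (suc h)) (suc c)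
  b = tails h (suc (suc c))
  regroup : ∀ a b e e′ → a + b + (e′ + e) ≡ a + e′ + (b + e)
  regroup = solve-∀

hump-identity : ∀ h b → 2 * tailHumps h b + suc h * nonRising h b ≡ suc h * delannoy (h + b) b
hump-identity zero    zero = refl
hump-identity (suc h) zero
  rewrite tailHumps-x-axis h | tails-x-axis h | delannoy-x-axis (h + 0) = refl
hump-identity zero (suc c) = begin
    2 * (e + s₁ + s₀) + 1 * 1
  ≡⟨ regroup e s₁ s₀ ⟩
    (2 * s₁ + 2 * e) + (2 * s₀ + 1 * 1)
  ≡⟨ cong₂ _+_ (hump-identity 1 c) (hump-identity 0 c) ⟩
    2 * d₁ + 1 * d₀
  ≡⟨ regroup′ d₁ d₀ ⟩
    1 * (d₁ + d₁ + d₀)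
  ≡⟨ cong (λ t → 1 * (d₁ + t + d₀)) (delannoy-sym (suc c) c) ⟩
    1 * (d₁ + delannoy c (suc c) + d₀) ∎
  where
  e s₁ s₀ d₁ d₀ : ℕ
  e  = drops 1 c
  s₁ = tailHumps 1 c
  s₀ = tailHumps 0 c
  d₁ = delannoy (suc c) c
  d₀ = delannoy c c
  regroup : ∀ e s₁ s₀ → 2 * (e + s₁ + s₀) + 1 * 1 ≡ (2 * s₁ + 2 * e) + (2 * s₀ + 1 * 1)
  regroup = solve-∀
  regroup′ : ∀ d₁ d₀ → 2 * d₁ + 1 * d₀ ≡ 1 * (d₁ + d₁ + d₀)
  regroup′ = solve-∀
hump-identity (suc h) (suc c) = begin
    2 * (e₁ + s₁ + s₂ + s₃) + (2 + h) * (r + e₃)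
  ≡⟨ cong (λ t → 2 * (e₁ + s₁ + s₂ + s₃) + (2 + h) * (t + e₃)) split ⟩
    2 * (e₁ + s₁ + s₂ + s₃) + (2 + h) * (e₁ + y₂ + e₃)
  ≡⟨ regroup h e₁ s₁ s₂ s₃ y₂ e₃ ⟩
    (2 * s₁ + (3 + h) * e₁) + (2 * s₂ + (1 + h) * y₂) + (2 * s₃ + (2 + h) * e₃) + (e₁ + y₂)
  ≡⟨ cong₂ _+_ (+₃-cong ih₁ (hump-identity h (suc c)) ih₃) (sym split) ⟩
    (3 + h) * d₁ + (1 + h) * d₂ + (2 + h) * d₃ + r
  ≡⟨ cong (λ t → (3 + h) * d₁ + (1 + h) * t + (2 + h) * d₃ + r) (sym reflected) ⟩
    (3 + h) * d₁ + (1 + h) * (d₁ + r) + (2 + h) * d₃ + r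
  ≡⟨ regroup′ h d₁ r d₃ ⟩
    (2 + h) * (d₁ + (d₁ + r) + d₃)
  ≡⟨ cong (λ t → (2 + h) * (d₁ + t + d₃)) reflected ⟩
    (2 + h) * (d₁ + d₂ + d₃) ∎
  where
  x e₁ e₃ s₁ s₂ s₃ r y₂ d₁ d₂ d₃ : ℕ
  x  = h + suc c
  e₁ = drops (suc (suc h)) c
  e₃ = drops (suc h) c
  s₁ = tailHumps (suc (suc h)) c
  s₂ = tailHumps h (suc c)
  s₃ = tailHumps (suc h) c
  r  = tails h (suc c)
  y₂ = nonRising h (suc c)
  d₁ = delannoy (suc x) c
  d₂ = delannoy x (suc c)
  d₃ = delannoy x c
  e : suc (h + c) ≡ x
  e = sym (+-suc h c)
  split : r ≡ e₁ + y₂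
  split = tails-split h c
  reflected : d₁ + r ≡ d₂
  reflected = reflection h (suc c)
  ih₁ : 2 * s₁ + (3 + h) * e₁ ≡ (3 + h) * d₁
  ih₁ = subst (λ t → 2 * s₁ + (3 + h) * e₁ ≡ (3 + h) * delannoy (suc t) c) e (hump-identity (suc (suc h)) c)
  ih₃ : 2 * s₃ + (2 + h) * e₃ ≡ (2 + h) * d₃
  ih₃ = subst (λ t → 2 * s₃ + (2 + h) * e₃ ≡ (2 + h) * delannoy t c) e (hump-identity (suc h) c)
  regroup : ∀ h e₁ s₁ s₂ s₃ y₂ e₃ → 2 * (e₁ + s₁ + s₂ + s₃) + (2 + h) * (e₁ + y₂ + e₃)
    ≡ (2 * s₁ + (3 + h) * e₁) + (2 * s₂ + (1 + h) * y₂) + (2 * s₃ + (2 + h) * e₃) + (e₁ + y₂)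
  regroup = solve-∀
  regroup′ : ∀ h d₁ r d₃ → (3 + h) * d₁ + (1 + h) * (d₁ + r) + (2 + h) * d₃ + r ≡ (2 + h) * (d₁ + (d₁ + r) + d₃)
  regroup′ = solve-∀

corollary4p1 : (n : ℕ) → (ss n ≡ 2 * hs n + 1) × (2 * hs n + 1 ≡ centralSum n)
corollary4p1 n = trans ss≡D (sym hs-identity) , trans hs-identity D≡centralSum
  where
  allLengths : Σ< (suc (n + n)) (λ L → nPaths L n n) ≡ delannoy n n
  allLengths = paths-delannoy (suc (n + n)) n n ≤-refl

  ss≡D : ss n ≡ delannoy n n
  ss≡D = trans (ss-paths n) allLengths

  hs-identity : 2 * hs n + 1 ≡ delannoy n n
  hs-identity = begin
      2 * hs n + 1
    ≡⟨ cong (λ t → 2 * t + 1) (hs-tailHumps n) ⟩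
      2 * tailHumps 0 n + 1 * nonRising 0 n
    ≡⟨ hump-identity 0 n ⟩
      1 * delannoy n n
    ≡⟨ *-identityˡ (delannoy n n) ⟩
      delannoy n n ∎

  D≡centralSum : delannoy n n ≡ centralSum n
  D≡centralSum = trans (sym allLengths) (paths-centralSum n)
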